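{- Let $X$ be a set of $n$ cards, $a,b,c$ positive integers with $a+b+c=n$, and let $d=a-c\ge 2$ with $b\ge d-1$. Suppose Alice's $(a,b,c)$-strategy is equitable, informative for Bob, and perfectly $(d-1)$-secure against Cathy. Then $a=d+1$ and hence $c=1$.
   Context: An $(a,b,c)$-deal is a uniformly random partition of $X$ into Alice's hand $H_A$ ($a$ cards), Bob's hand $H_B$ ($b$ cards) and Cathy's hand $H_C$ ($c$ cards). An announcement is a set of $a$-subsets of $X$. An $(a,b,c)$-strategy consists of announcements $\mathcal{A}_1,\dots,\mathcal{A}_m$ covering all $a$-subsets of $X$ together with, for each $H_A$, a probability distribution $p_{H_A}$ with positive values on $g(H_A)=\{i : H_A\in\mathcal{A}_i\}$; Alice broadcasts an index $i$ chosen according to $p_{H_A}$. It is equitable if there is $\gamma$ with $|g(H_A)|=\gamma$ for all $H_A$ and every $p_{H_A}$ uniform. For $H\subseteq X$, $\mathcal{P}(H,i)=\{H_A\in\mathcal{A}_i : H_A\cap H=\emptyset\}$. Informative for Bob: $|\mathcal{P}(H_B,i)|\le 1$ for every $b$-subset $H_B$ and every $i$. For $1\le\delta\le a$, the strategy is perfectly $\delta$-secure against Cathy if for every $\delta'$ with $1\le\delta'\le\delta$, every $i$, every $c$-subset $H_C$ with $\mathcal{P}(H_C,i)\neq\emptyset$ and all distinct $x_1,\dots,x_{\delta'}\in X\setminus H_C$, $\Pr[x_1,\dots,x_{\delta'}\in H_A\mid i,H_C]=\binom{a}{\delta'}/\binom{a+b}{\delta'}$ (probability over the deal and Alice's choice).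 -}

module Defs where

open import Data.Bool using (Bool; true; false; _∧_; not; T)
open import Data.Nat using (ℕ; zero; suc; _+_; _*_; _≤_)
open import Data.Nat.Combinatorics using (_C_)
open import Data.Fin using (Fin)
open import Data.Fin.Subset using (Subset; ∣_∣; _∈_; _∉_)
open import Data.Vec using (Vec; []; _∷_)
open import Data.List using (List; []; _∷_; map; _++_; length; filterᵇ; allFin)
open import Data.Product using (Σ; _×_)
open import Function.Definitions using (Injective)
open import Relation.Binary.PropositionalEquality using (_≡_)
open import Relation.Nullary using (¬_)

allSubsets : (n : ℕ) → List (Subset n)
allSubsets zero = [] ∷ []
allSubsets (suc n) = map (true ∷_) (allSubsets n) ++ map (false ∷_) (allSubsets n)

disjointᵇ : {n : ℕ} → Subset n → Subset n → Bool
disjointᵇ [] [] = true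
disjointᵇ (x ∷ p) (y ∷ q) = not (x ∧ y) ∧ disjointᵇ p q

countSubsets : (n : ℕ) → (Subset n → Bool) → ℕ
countSubsets n P = length (filterᵇ P (allSubsets n))

-- A family of announcements A_1..A_m (indexed by Fin m) of a-subsets of X.
-- ann i H = true means H ∈ A_i.  Every member of an announcement is an a-subset.
record Announcements (n a : ℕ) : Set where
  field
    m      : ℕ
    ann    : Fin m → Subset n → Bool
    wf     : ∀ i H → T (ann i H) → ∣ H ∣ ≡ a

open Announcements public

gSize : {n a : ℕ} → Announcements n a → Subset n → ℕ
gSize 𝒜 H = length (filterᵇ (λ i → ann 𝒜 i H) (allFin (m 𝒜)))

Covering : {n a : ℕ} → Announcements n a → Set
Covering {n} {a} 𝒜 = ∀ (H : Subset n) → ∣ H ∣ ≡ a → Σ (Fin (m 𝒜)) λ i → T (ann 𝒜 i H)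

-- An equitable (a,b,c)-strategy: covering announcements, every a-subset lies in
-- exactly γ announcements, and Alice picks uniformly among g(H_A).  Since the
-- distributions are then uniform, the strategy is fully determined by the
-- announcements together with this property.
Equitable : {n a : ℕ} → Announcements n a → Set
Equitable {n} {a} 𝒜 =
  Covering 𝒜 × Σ ℕ (λ γ → ∀ (H : Subset n) → ∣ H ∣ ≡ a → gSize 𝒜 H ≡ γ)

Psize : {n a : ℕ} → (𝒜 : Announcements n a) → Fin (m 𝒜) → Subset n → ℕ
Psize {n} 𝒜 i H = length (filterᵇ (λ HA → ann 𝒜 i HA ∧ disjointᵇ HA H) (allSubsets n))

Informative : {n a : ℕ} → Announcements n a → (b : ℕ) → Set
Informative {n} 𝒜 b = ∀ (HB : Subset n) → ∣ HB ∣ ≡ b → ∀ i → Psize 𝒜 i HB ≤ 1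

allInᵇ : {n k : ℕ} → (Fin k → Fin n) → Subset n → Bool
allInᵇ {n} {zero} x H = true
allInᵇ {n} {suc k} x H = Data.Vec.lookup H (x Fin.zero) ∧ allInᵇ (λ j → x (Fin.suc j)) H
  where import Data.Fin as Fin

PsizeWith : {n a k : ℕ} → (𝒜 : Announcements n a) → Fin (m 𝒜) → Subset n → (Fin k → Fin n) → ℕ
PsizeWith {n} 𝒜 i H x =
  length (filterᵇ (λ HA → ann 𝒜 i HA ∧ disjointᵇ HA H ∧ allInᵇ x HA) (allSubsets n))

-- Perfect δ-security against Cathy, for an EQUITABLE strategy.
-- For an equitable strategy every outcome (deal, announcement index i) with
-- H_A ∈ A_i has the same probability 1/(#deals·γ), and a deal is determined by
-- (H_A, H_C) (H_B = complement).  Hence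
--   Pr[x_1..x_δ' ∈ H_A | i, H_C] = PsizeWith / Psize,
-- and the required equality  PsizeWith/Psize = C(a,δ')/C(a+b,δ')  is stated
-- cross-multiplied in ℕ.
PerfectlySecure : {n a : ℕ} → Announcements n a → (b c δ : ℕ) → Set
PerfectlySecure {n} {a} 𝒜 b c δ =
  ∀ (δ' : ℕ) → 1 ≤ δ' → δ' ≤ δ →
  ∀ (i : Fin (m 𝒜)) (HC : Subset n) → ∣ HC ∣ ≡ c → ¬ (Psize 𝒜 i HC ≡ 0) →
  ∀ (x : Fin δ' → Fin n) → Injective _≡_ _≡_ x → (∀ j → x j ∉ HC) →
  PsizeWith 𝒜 i HC x * ((a + b) C δ') ≡ Psize 𝒜 i HC * (a C δ')

-- Suppose c ≥ 2 and put d = a − c; fix an announcement A_i and call its members blocks.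
-- Informativeness forces two blocks sharing d cards to coincide. Perfect (d − 1)-security
-- says that, for a c-set S, the number of blocks avoiding S and containing d − 1 given
-- cards outside S does not depend on those cards. Fix d − 2 cards T₀ and, for a
-- (c − 1)-set Q, let M(s, z) ∈ {0, 1} count the blocks avoiding Q through T₀ ∪ {s, z}.
-- Splitting the blocks avoiding Q through T₀ ∪ {z} by whether they contain s turns
-- security for Q ∪ {s} and Q ∪ {s'} into M(s, z) + M(s', z') = M(s', z) + M(s, z').
-- A block B ⊇ T₀ has a companion block B₂ with B ∩ B₂ = T₀ ∪ {p}. With Q inside B the
-- identity yields a third block through T₀, a card of B and a card of B₂; with Q inside
-- B₂ it then reads (0 + at most 1) = (at least 1 + at least 1), which is absurd.

module Submission where

open import Data.Bool using (Bool; true; false; T; T?; _∧_; not)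
open import Data.Bool.Properties using (T-∧; T-≡)
open import Data.Empty using (⊥; ⊥-elim)
open import Data.Fin using (Fin; zero; suc)
import Data.Fin.Properties as Fin
open import Data.Fin.Subset renaming (⊥ to ∅)
open import Data.Fin.Subset.Properties
open import Data.List using ([]; _∷_; map; length; filterᵇ; _++_)
open import Data.List.Properties using (filter-++; length-++; filter-some; filter-none; length-filter)
open import Data.List.Relation.Unary.All using (universal)
open import Data.List.Relation.Unary.Any using (here)
open import Data.Nat using (ℕ; zero; suc; _+_; _*_; _∸_; _≤_; _<_; _≟_; z≤n; s≤s; NonZero; >-nonZero)
open import Data.Nat.Combinatorics using (_C_; nCk+nC[k+1]≡[n+1]C[k+1])
open import Data.Nat.Properties
open import Data.Nat.Tactic.RingSolver using (solve-∀)
open import Data.Product using (∃; ∃₂; _×_; _,_; proj₁; proj₂)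
open import Data.Product.Function.NonDependent.Propositional using (_×-⇔_)
open import Data.Sum using (inj₁; inj₂)
open import Data.Vec using ([]; _∷_; here; there; lookup)
open import Data.Vec.Properties using (∷-injectiveˡ; ∷-injectiveʳ; lookup⇒[]=; []=⇒lookup)
open import Data.Vec.Functional using () renaming (_∷_ to _∷ᶠ_)
open import Function using (_∘_; case_of_)
open import Function.Bundles using (_⇔_; mk⇔; Equivalence)
open import Function.Construct.Composition using (_⇔-∘_)
open import Function.Construct.Identity using (⇔-id)
open import Function.Definitions using (Injective)
open import Relation.Binary.PropositionalEquality
open import Relation.Nullary using (¬_; Dec; yes; no; contradiction)
open import Defs

private variable
  n : ℕ
  p q : Subset n
  x y : Fin n
  P Q : Subset n → Bool

-- Subsets of Fin n

Disjoint : Subset n → Subset n → Set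
Disjoint p q = ∀ {x} → x ∈ p → x ∉ q

Disjoint-sym : Disjoint p q → Disjoint q p
Disjoint-sym p#q x∈q x∈p = p#q x∈p x∈q

∉-∪⁺ : x ∉ p → x ∉ q → x ∉ p ∪ q
∉-∪⁺ {p = p} {q = q} x∉p x∉q x∈ with x∈p∪q⁻ p q x∈
... | inj₁ x∈p = x∉p x∈p
... | inj₂ x∈q = x∉q x∈q

∉-∪⁻ : x ∉ p ∪ q → x ∉ p × x ∉ q
∉-∪⁻ x∉ = (λ x∈p → x∉ (x∈p∪q⁺ (inj₁ x∈p))) , (λ x∈q → x∉ (x∈p∪q⁺ (inj₂ x∈q)))

∉-∪⁅⁆⁺ : x ∉ p → x ≢ y → x ∉ p ∪ ⁅ y ⁆
∉-∪⁅⁆⁺ x∉p x≢y = ∉-∪⁺ x∉p (x≢y⇒x∉⁅y⁆ x≢y)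

∉-∪⁅⁆⁻ : x ∉ p ∪ ⁅ y ⁆ → x ∉ p × x ≢ y
∉-∪⁅⁆⁻ x∉ = let x∉p , x∉⁅y⁆ = ∉-∪⁻ x∉ in x∉p , x∉⁅y⁆⇒x≢y x∉⁅y⁆

∪⁅⁆⊆ : ∀ {r : Subset n} → p ⊆ r → x ∈ r → p ∪ ⁅ x ⁆ ⊆ r
∪⁅⁆⊆ {p = p} {x = x} p⊆r x∈r y∈ with x∈p∪q⁻ p ⁅ x ⁆ y∈
... | inj₁ y∈p = p⊆r y∈p
... | inj₂ y∈⁅x⁆ = subst (_∈ _) (sym (x∈⁅y⁆⇒x≡y x y∈⁅x⁆)) x∈r

x∈p─q⇒x∉q : ∀ (p q : Subset n) → x ∈ p ─ q → x ∉ q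
x∈p─q⇒x∉q (true ∷ p) (false ∷ q) here = λ ()
x∈p─q⇒x∉q (_ ∷ p) (_ ∷ q) (there x∈) (there x∈q) = x∈p─q⇒x∉q p q x∈ x∈q

T-lookup⇔∈ : ∀ (p : Subset n) x → T (lookup p x) ⇔ x ∈ p
T-lookup⇔∈ p x =
  mk⇔ (λ t → lookup⇒[]= x p (Equivalence.to T-≡ t)) (λ x∈p → Equivalence.from T-≡ ([]=⇒lookup x∈p))

∉⇔T-not-lookup : ∀ (p : Subset n) x → x ∉ p ⇔ T (not (lookup p x))
∉⇔T-not-lookup (true ∷ p) zero = mk⇔ (λ x∉p → x∉p here) λ ()
∉⇔T-not-lookup (false ∷ p) zero = mk⇔ _ λ _ ()
∉⇔T-not-lookup (_ ∷ p) (suc x) =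
  mk⇔ (λ x∉ → Equivalence.to IH (x∉ ∘ there)) (λ t → λ { (there x∈p) → Equivalence.from IH t x∈p })
  where IH = ∉⇔T-not-lookup p x

disjointᵇ⇔Disjoint : ∀ (p q : Subset n) → T (disjointᵇ p q) ⇔ Disjoint p q
disjointᵇ⇔Disjoint p q = mk⇔ (to p q) (from p q)
  where
  to : ∀ {n} (p q : Subset n) → T (disjointᵇ p q) → Disjoint p q
  to (true ∷ p) (false ∷ q) d here = λ ()
  to (x ∷ p) (y ∷ q) d (there x∈p) (there x∈q) = to p q (proj₂ (Equivalence.to T-∧ d)) x∈p x∈q
  to (true ∷ p) (true ∷ q) () here
  from : ∀ {n} (p q : Subset n) → Disjoint p q → T (disjointᵇ p q)
  from [] [] _ = _
  from (true ∷ p) (true ∷ q) d = ⊥-elim (d here here)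
  from (true ∷ p) (false ∷ q) d = from p q (λ x∈p x∈q → d (there x∈p) (there x∈q))
  from (false ∷ p) (y ∷ q) d = from p q (λ x∈p x∈q → d (there x∈p) (there x∈q))

allInᵇ⇔∀∈ : ∀ {k} (x : Fin k → Fin n) (p : Subset n) → T (allInᵇ x p) ⇔ (∀ j → x j ∈ p)
allInᵇ⇔∀∈ {k = zero} x p = mk⇔ (λ _ ()) (λ _ → _)
allInᵇ⇔∀∈ {k = suc k} x p = mk⇔ to from
  where
  IH = allInᵇ⇔∀∈ (x ∘ suc) p
  to : T (allInᵇ x p) → ∀ j → x j ∈ p
  to t zero = Equivalence.to (T-lookup⇔∈ p (x zero)) (proj₁ (Equivalence.to T-∧ t))
  to t (suc j) = Equivalence.to IH (proj₂ (Equivalence.to T-∧ t)) j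
  from : (∀ j → x j ∈ p) → T (allInᵇ x p)
  from all = Equivalence.from T-∧ (Equivalence.from (T-lookup⇔∈ p (x zero)) (all zero) , Equivalence.from IH (all ∘ suc))

∣p∪q∣+∣p∩q∣≡∣p∣+∣q∣ : ∀ (p q : Subset n) → ∣ p ∪ q ∣ + ∣ p ∩ q ∣ ≡ ∣ p ∣ + ∣ q ∣
∣p∪q∣+∣p∩q∣≡∣p∣+∣q∣ [] [] = refl
∣p∪q∣+∣p∩q∣≡∣p∣+∣q∣ (true ∷ p) (true ∷ q) =
  cong suc (trans (+-suc _ _) (trans (cong suc (∣p∪q∣+∣p∩q∣≡∣p∣+∣q∣ p q)) (sym (+-suc _ _))))
∣p∪q∣+∣p∩q∣≡∣p∣+∣q∣ (true ∷ p) (false ∷ q) = cong suc (∣p∪q∣+∣p∩q∣≡∣p∣+∣q∣ p q)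
∣p∪q∣+∣p∩q∣≡∣p∣+∣q∣ (false ∷ p) (true ∷ q) = trans (cong suc (∣p∪q∣+∣p∩q∣≡∣p∣+∣q∣ p q)) (sym (+-suc _ _))
∣p∪q∣+∣p∩q∣≡∣p∣+∣q∣ (false ∷ p) (false ∷ q) = ∣p∪q∣+∣p∩q∣≡∣p∣+∣q∣ p q

∣p∪q∣≤∣p∣+∣q∣ : ∀ (p q : Subset n) → ∣ p ∪ q ∣ ≤ ∣ p ∣ + ∣ q ∣
∣p∪q∣≤∣p∣+∣q∣ p q = ≤-trans (m≤m+n _ _) (≤-reflexive (∣p∪q∣+∣p∩q∣≡∣p∣+∣q∣ p q))

∣p∪⁅x⁆∣≤1+∣p∣ : ∀ (p : Subset n) x → ∣ p ∪ ⁅ x ⁆ ∣ ≤ suc ∣ p ∣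
∣p∪⁅x⁆∣≤1+∣p∣ p x =
  ≤-trans (∣p∪q∣≤∣p∣+∣q∣ p ⁅ x ⁆) (≤-reflexive (trans (cong (∣ p ∣ +_) (∣⁅x⁆∣≡1 x)) (+-comm _ 1)))

x∉p⇒∣p∪⁅x⁆∣≡1+∣p∣ : ∀ {n} {p : Subset n} {x} → x ∉ p → ∣ p ∪ ⁅ x ⁆ ∣ ≡ suc ∣ p ∣
x∉p⇒∣p∪⁅x⁆∣≡1+∣p∣ {n} {p} {x} x∉p = begin
  ∣ p ∪ ⁅ x ⁆ ∣                  ≡⟨ +-identityʳ _ ⟨
  ∣ p ∪ ⁅ x ⁆ ∣ + 0              ≡⟨ cong (∣ p ∪ ⁅ x ⁆ ∣ +_) (∣⊥∣≡0 n) ⟨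
  ∣ p ∪ ⁅ x ⁆ ∣ + ∣ ∅ {n} ∣      ≡⟨ cong (λ r → ∣ p ∪ ⁅ x ⁆ ∣ + ∣ r ∣) p∩⁅x⁆≡∅ ⟨
  ∣ p ∪ ⁅ x ⁆ ∣ + ∣ p ∩ ⁅ x ⁆ ∣  ≡⟨ ∣p∪q∣+∣p∩q∣≡∣p∣+∣q∣ p ⁅ x ⁆ ⟩
  ∣ p ∣ + ∣ ⁅ x ⁆ ∣              ≡⟨ cong (∣ p ∣ +_) (∣⁅x⁆∣≡1 x) ⟩
  ∣ p ∣ + 1                      ≡⟨ +-comm _ 1 ⟩
  suc ∣ p ∣                      ∎
  where
  open ≡-Reasoning
  p∩⁅x⁆≡∅ : p ∩ ⁅ x ⁆ ≡ ∅ {n}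
  p∩⁅x⁆≡∅ = Empty-unique λ (y , y∈) →
    let y∈p , y∈⁅x⁆ = x∈p∩q⁻ p ⁅ x ⁆ y∈ in x∉p (subst (_∈ p) (x∈⁅y⁆⇒x≡y x y∈⁅x⁆) y∈p)

∣p∣≤∣p─q∣+∣q∣ : ∀ (p q : Subset n) → ∣ p ∣ ≤ ∣ p ─ q ∣ + ∣ q ∣
∣p∣≤∣p─q∣+∣q∣ [] [] = z≤n
∣p∣≤∣p─q∣+∣q∣ (true ∷ p) (true ∷ q) = ≤-trans (s≤s (∣p∣≤∣p─q∣+∣q∣ p q)) (≤-reflexive (sym (+-suc _ _)))
∣p∣≤∣p─q∣+∣q∣ (true ∷ p) (false ∷ q) = s≤s (∣p∣≤∣p─q∣+∣q∣ p q)
∣p∣≤∣p─q∣+∣q∣ (false ∷ p) (true ∷ q) = ≤-trans (∣p∣≤∣p─q∣+∣q∣ p q) (+-monoʳ-≤ _ (n≤1+n _))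
∣p∣≤∣p─q∣+∣q∣ (false ∷ p) (false ∷ q) = ∣p∣≤∣p─q∣+∣q∣ p q

∃⊆-of-size : ∀ {m} (p : Subset n) → m ≤ ∣ p ∣ → ∃ λ q → q ⊆ p × ∣ q ∣ ≡ m
∃⊆-of-size {n} {zero} p _ = ∅ , ⊥⊆ , ∣⊥∣≡0 n
∃⊆-of-size {m = suc m} (true ∷ p) (s≤s m≤) =
  let q , q⊆p , ∣q∣≡m = ∃⊆-of-size p m≤ in true ∷ q , in⊆in q⊆p , cong suc ∣q∣≡m
∃⊆-of-size {m = suc m} (false ∷ p) m≤ =
  let q , q⊆p , ∣q∣≡m = ∃⊆-of-size p m≤ in false ∷ q , out⊆ q⊆p , ∣q∣≡m

∣p∣>0⇒Nonempty : ∀ (p : Subset n) → 0 < ∣ p ∣ → Nonempty p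
∣p∣>0⇒Nonempty {n} p 0<∣p∣ with nonempty? p
... | yes ne = ne
... | no empty = contradiction (trans (cong ∣_∣ (Empty-unique empty)) (∣⊥∣≡0 n)) (>⇒≢ 0<∣p∣)

∃∈-outside : ∀ (p q : Subset n) → ∣ q ∣ < ∣ p ∣ → ∃ λ x → x ∈ p × x ∉ q
∃∈-outside p q ∣q∣<∣p∣ =
  let x , x∈ = ∣p∣>0⇒Nonempty (p ─ q) (+-cancelʳ-< _ 0 _ (≤-trans ∣q∣<∣p∣ (∣p∣≤∣p─q∣+∣q∣ p q)))
  in x , p─q⊆p p q x∈ , x∈p─q⇒x∉q p q x∈

∃⊆-outside : ∀ {m} (p q : Subset n) → m + ∣ q ∣ ≤ ∣ p ∣ → ∃ λ r → r ⊆ p × Disjoint r q × ∣ r ∣ ≡ m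
∃⊆-outside p q m+∣q∣≤∣p∣ =
  let r , r⊆ , ∣r∣≡m = ∃⊆-of-size (p ─ q) (+-cancelʳ-≤ _ _ _ (≤-trans m+∣q∣≤∣p∣ (∣p∣≤∣p─q∣+∣q∣ p q)))
  in r , p─q⊆p p q ∘ r⊆ , x∈p─q⇒x∉q p q ∘ r⊆ , ∣r∣≡m

record Enumeration (p : Subset n) : Set where
  field
    point     : Fin ∣ p ∣ → Fin n
    injective : Injective _≡_ _≡_ point
    point∈    : ∀ j → point j ∈ p
    onto      : ∀ {x} → x ∈ p → ∃ λ j → point j ≡ x

  points⊆⇒⊆ : ∀ {r : Subset n} → (∀ j → point j ∈ r) → p ⊆ r
  points⊆⇒⊆ {r} all x∈p = let j , eq = onto x∈p in subst (_∈ r) eq (all j)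

enumerate : ∀ (p : Subset n) → Enumeration p
enumerate [] = record { point = λ () ; injective = λ {} ; point∈ = λ () ; onto = λ () }
enumerate (false ∷ p) = record
  { point = suc ∘ point ; injective = injective ∘ Fin.suc-injective
  ; point∈ = there ∘ point∈ ; onto = λ { (there x∈p) → let j , eq = onto x∈p in j , cong suc eq } }
  where open Enumeration (enumerate p)
enumerate (true ∷ p) = record { point = point′ ; injective = injective′ ; point∈ = point∈′ ; onto = onto′ }
  where
  open Enumeration (enumerate p)
  point′ : Fin (suc ∣ p ∣) → Fin _
  point′ zero = zero
  point′ (suc j) = suc (point j)
  injective′ : Injective _≡_ _≡_ point′
  injective′ {zero} {zero} _ = refl
  injective′ {suc i} {suc j} eq = cong suc (injective (Fin.suc-injective eq))
  point∈′ : ∀ j → point′ j ∈ true ∷ p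
  point∈′ zero = here
  point∈′ (suc j) = there (point∈ j)
  onto′ : ∀ {x} → x ∈ true ∷ p → ∃ λ j → point′ j ≡ x
  onto′ here = zero , refl
  onto′ (there x∈p) = let j , eq = onto x∈p in suc j , cong suc eq

-- Counting subsets

module _ {A B : Set} where

  length-filterᵇ-map : ∀ (P : B → Bool) (f : A → B) xs →
    length (filterᵇ P (map f xs)) ≡ length (filterᵇ (P ∘ f) xs)
  length-filterᵇ-map P f [] = refl
  length-filterᵇ-map P f (x ∷ xs) with P (f x)
  ... | true = cong suc (length-filterᵇ-map P f xs)
  ... | false = length-filterᵇ-map P f xs

module _ {A : Set} where

  length-filterᵇ-mono : ∀ {P Q : A → Bool} → (∀ x → T (P x) → T (Q x)) → ∀ xs →
    length (filterᵇ P xs) ≤ length (filterᵇ Q xs)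
  length-filterᵇ-mono P⇒Q [] = z≤n
  length-filterᵇ-mono {P} {Q} P⇒Q (x ∷ xs) with P x in eqP | Q x in eqQ
  ... | true | true = s≤s (length-filterᵇ-mono P⇒Q xs)
  ... | false | true = m≤n⇒m≤1+n (length-filterᵇ-mono P⇒Q xs)
  ... | false | false = length-filterᵇ-mono P⇒Q xs
  ... | true | false = contradiction (subst T eqQ (P⇒Q x (subst T (sym eqP) _))) λ ()

  length-filterᵇ-split : ∀ (P Q : A → Bool) xs →
    length (filterᵇ P xs) ≡ length (filterᵇ (λ x → P x ∧ Q x) xs) + length (filterᵇ (λ x → P x ∧ not (Q x)) xs)
  length-filterᵇ-split P Q [] = refl
  length-filterᵇ-split P Q (x ∷ xs) with P x | Q x
  ... | true | true = cong suc (length-filterᵇ-split P Q xs)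
  ... | true | false = trans (cong suc (length-filterᵇ-split P Q xs)) (sym (+-suc _ _))
  ... | false | _ = length-filterᵇ-split P Q xs

  length-filterᵇ-witness : ∀ (P : A → Bool) xs → 0 < length (filterᵇ P xs) → ∃ λ x → T (P x)
  length-filterᵇ-witness P (x ∷ xs) pos with P x in eq
  ... | true = x , subst T (sym eq) _
  ... | false = length-filterᵇ-witness P xs pos

countSubsets-suc : ∀ (P : Subset (suc n) → Bool) →
  countSubsets (suc n) P ≡ countSubsets n (P ∘ (true ∷_)) + countSubsets n (P ∘ (false ∷_))
countSubsets-suc {n} P = begin
  length (filterᵇ P (map (true ∷_) Hs ++ map (false ∷_) Hs))
    ≡⟨ cong length (filter-++ (T? ∘ P) (map (true ∷_) Hs) (map (false ∷_) Hs)) ⟩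
  length (filterᵇ P (map (true ∷_) Hs) ++ filterᵇ P (map (false ∷_) Hs))
    ≡⟨ length-++ (filterᵇ P (map (true ∷_) Hs)) ⟩
  length (filterᵇ P (map (true ∷_) Hs)) + length (filterᵇ P (map (false ∷_) Hs))
    ≡⟨ cong₂ _+_ (length-filterᵇ-map P (true ∷_) Hs) (length-filterᵇ-map P (false ∷_) Hs) ⟩
  countSubsets n (P ∘ (true ∷_)) + countSubsets n (P ∘ (false ∷_)) ∎
  where
  open ≡-Reasoning
  Hs = allSubsets n

countSubsets-mono : (∀ H → T (P H) → T (Q H)) → countSubsets n P ≤ countSubsets n Q
countSubsets-mono {n} P⇒Q = length-filterᵇ-mono P⇒Q (allSubsets n)

countSubsets-cong : (∀ H → T (P H) ⇔ T (Q H)) → countSubsets n P ≡ countSubsets n Q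
countSubsets-cong P⇔Q =
  ≤-antisym (countSubsets-mono (Equivalence.to ∘ P⇔Q)) (countSubsets-mono (Equivalence.from ∘ P⇔Q))

countSubsets-split : ∀ (P Q : Subset n → Bool) →
  countSubsets n P ≡ countSubsets n (λ H → P H ∧ Q H) + countSubsets n (λ H → P H ∧ not (Q H))
countSubsets-split {n} P Q = length-filterᵇ-split P Q (allSubsets n)

countSubsets-witness : 0 < countSubsets n P → ∃ λ H → T (P H)
countSubsets-witness {n} {P} = length-filterᵇ-witness P (allSubsets n)

countSubsets-pos : ∀ {H} → T (P H) → 0 < countSubsets n P
countSubsets-pos {P = P} {H = []} pH = filter-some (T? ∘ P) (here pH)
countSubsets-pos {P = P} {H = true ∷ H} pH rewrite countSubsets-suc P =
  ≤-trans (countSubsets-pos {P = P ∘ (true ∷_)} pH) (m≤m+n _ _)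
countSubsets-pos {P = P} {H = false ∷ H} pH rewrite countSubsets-suc P =
  ≤-trans (countSubsets-pos {P = P ∘ (false ∷_)} pH) (m≤n+m _ _)

countSubsets-zero : (∀ H → ¬ T (P H)) → countSubsets n P ≡ 0
countSubsets-zero {n} {P} none = cong length (filter-none (T? ∘ P) (universal none (allSubsets n)))

countSubsets-≤1 : (∀ {H H'} → T (P H) → T (P H') → H ≡ H') → countSubsets n P ≤ 1
countSubsets-≤1 {zero} {P} unique = length-filter (T? ∘ P) (allSubsets 0)
countSubsets-≤1 {suc n} {P} unique rewrite countSubsets-suc P with countSubsets n (P ∘ (true ∷_)) in eq
... | zero = countSubsets-≤1 (λ pH pH' → ∷-injectiveʳ (unique pH pH'))
... | suc m = begin
  suc m + countSubsets n (P ∘ (false ∷_)) ≡⟨ cong (suc m +_) (countSubsets-zero none-false) ⟩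
  suc m + 0                               ≡⟨ +-identityʳ _ ⟩
  suc m                                   ≡⟨ eq ⟨
  countSubsets n (P ∘ (true ∷_))          ≤⟨ countSubsets-≤1 (λ pH pH' → ∷-injectiveʳ (unique pH pH')) ⟩
  1                                       ∎
  where
  open ≤-Reasoning
  none-false : ∀ H → ¬ T (P (false ∷ H))
  none-false H pH with countSubsets-witness {P = P ∘ (true ∷_)} (subst (0 <_) (sym eq) (s≤s z≤n))
  ... | _ , pH′ = contradiction (∷-injectiveˡ (unique pH′ pH)) λ ()

countSubsets-≤1⇒unique : countSubsets n P ≤ 1 → ∀ {H H'} → T (P H) → T (P H') → H ≡ H'
countSubsets-≤1⇒unique {zero} _ {[]} {[]} _ _ = refl
countSubsets-≤1⇒unique {suc n} {P} ≤1 = cases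
  where
  split≤1 : countSubsets n (P ∘ (true ∷_)) + countSubsets n (P ∘ (false ∷_)) ≤ 1
  split≤1 = subst (_≤ 1) (countSubsets-suc P) ≤1
  not-both : ∀ {H H'} → T (P (true ∷ H)) → T (P (false ∷ H')) → ⊥
  not-both pH pH' = contradiction
    (≤-trans (+-mono-≤ (countSubsets-pos {P = P ∘ (true ∷_)} pH) (countSubsets-pos {P = P ∘ (false ∷_)} pH')) split≤1)
    λ { (s≤s ()) }
  cases : ∀ {H H'} → T (P H) → T (P H') → H ≡ H'
  cases {true ∷ H} {true ∷ H'} pH pH' =
    cong (true ∷_) (countSubsets-≤1⇒unique (≤-trans (m≤m+n _ _) split≤1) pH pH')
  cases {false ∷ H} {false ∷ H'} pH pH' =
    cong (false ∷_) (countSubsets-≤1⇒unique (≤-trans (m≤n+m _ _) split≤1) pH pH')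
  cases {true ∷ H} {false ∷ H'} pH pH' = ⊥-elim (not-both pH pH')
  cases {false ∷ H} {true ∷ H'} pH pH' = ⊥-elim (not-both pH' pH)

nCk>0 : ∀ {n k} → k ≤ n → 0 < n C k
nCk>0 {n} {zero} _ = s≤s z≤n
nCk>0 {suc n} {suc k} (s≤s k≤n) =
  subst (0 <_) (nCk+nC[k+1]≡[n+1]C[k+1] n k) (≤-trans (nCk>0 k≤n) (m≤m+n _ _))

-- Blocks of one announcement

Outside : ∀ {n k} → Subset n → (Fin k → Fin n) → Set
Outside S x = Injective _≡_ _≡_ x × (∀ j → x j ∉ S)

module _ {n a : ℕ} (𝒜 : Announcements n a) (i : Fin (m 𝒜)) where

  Block : Subset n → Set
  Block H = T (ann 𝒜 i H)

  Psize-spec : ∀ S H → T (ann 𝒜 i H ∧ disjointᵇ H S) ⇔ (Block H × Disjoint H S)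
  Psize-spec S H = (⇔-id _ ×-⇔ disjointᵇ⇔Disjoint H S) ⇔-∘ T-∧

  Psize-pos : ∀ {S B} → Block B → Disjoint B S → 0 < Psize 𝒜 i S
  Psize-pos {S} {B} bB B#S =
    countSubsets-pos {P = λ H → ann 𝒜 i H ∧ disjointᵇ H S} (Equivalence.from (Psize-spec S B) (bB , B#S))

  avoidingBlockᵇ : ∀ {k} → Subset n → (Fin k → Fin n) → Subset n → Bool
  avoidingBlockᵇ S x H = ann 𝒜 i H ∧ disjointᵇ H S ∧ allInᵇ x H

  PsizeWith-spec : ∀ {k} S (x : Fin k → Fin n) H →
    T (avoidingBlockᵇ S x H) ⇔ (Block H × Disjoint H S × (∀ j → x j ∈ H))
  PsizeWith-spec S x H = (⇔-id _ ×-⇔ ((disjointᵇ⇔Disjoint H S ×-⇔ allInᵇ⇔∀∈ x H) ⇔-∘ T-∧)) ⇔-∘ T-∧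

  PsizeWith-witness : ∀ {k S} {x : Fin k → Fin n} → 0 < PsizeWith 𝒜 i S x →
    ∃ λ H → Block H × Disjoint H S × (∀ j → x j ∈ H)
  PsizeWith-witness {S = S} {x} pos =
    let H , pH = countSubsets-witness {P = avoidingBlockᵇ S x} pos in H , Equivalence.to (PsizeWith-spec S x H) pH

  informative⇒blocks-coincide : ∀ {b c} → Informative 𝒜 b → a + b + c ≡ n →
    ∀ {H H' X} → Block H → Block H' → X ⊆ H → X ⊆ H' → a ≤ ∣ X ∣ + c → H ≡ H'
  informative⇒blocks-coincide {b} {c} informative a+b+c≡n {H} {H'} {X} bH bH' X⊆H X⊆H' a≤∣X∣+c =
    let HB , _ , HB#H∪H' , ∣HB∣≡b = ∃⊆-outside (⊤ {n}) (H ∪ H') b+∣H∪H'∣≤n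
    in countSubsets-≤1⇒unique (informative HB ∣HB∣≡b i)
         (Equivalence.from (Psize-spec HB H) (bH , λ x∈H x∈HB → HB#H∪H' x∈HB (p⊆p∪q H' x∈H)))
         (Equivalence.from (Psize-spec HB H') (bH' , λ x∈H' x∈HB → HB#H∪H' x∈HB (q⊆p∪q H H' x∈H')))
    where
    open ≤-Reasoning
    ∣H∪H'∣≤a+c : ∣ H ∪ H' ∣ ≤ a + c
    ∣H∪H'∣≤a+c = +-cancelʳ-≤ ∣ X ∣ _ _ (begin
      ∣ H ∪ H' ∣ + ∣ X ∣        ≤⟨ +-monoʳ-≤ _ (p⊆q⇒∣p∣≤∣q∣ (λ x∈X → x∈p∩q⁺ (X⊆H x∈X , X⊆H' x∈X))) ⟩
      ∣ H ∪ H' ∣ + ∣ H ∩ H' ∣   ≡⟨ ∣p∪q∣+∣p∩q∣≡∣p∣+∣q∣ H H' ⟩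
      ∣ H ∣ + ∣ H' ∣            ≡⟨ cong₂ _+_ (wf 𝒜 i H bH) (wf 𝒜 i H' bH') ⟩
      a + a                     ≤⟨ +-monoʳ-≤ a a≤∣X∣+c ⟩
      a + (∣ X ∣ + c)           ≡⟨ rearrange a ∣ X ∣ c ⟩
      a + c + ∣ X ∣             ∎)
      where
      rearrange : ∀ a x c → a + (x + c) ≡ a + c + x
      rearrange = solve-∀
    b+∣H∪H'∣≤n : b + ∣ H ∪ H' ∣ ≤ ∣ ⊤ {n} ∣
    b+∣H∪H'∣≤n = begin
      b + ∣ H ∪ H' ∣ ≤⟨ +-monoʳ-≤ b ∣H∪H'∣≤a+c ⟩
      b + (a + c)    ≡⟨ rearrange a b c ⟩
      a + b + c      ≡⟨ a+b+c≡n ⟩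
      n              ≡⟨ ∣⊤∣≡n n ⟨
      ∣ ⊤ {n} ∣      ∎
      where
      rearrange : ∀ a b c → b + (a + c) ≡ a + b + c
      rearrange = solve-∀

  PsizeWith≤Psize : ∀ {k} S (x : Fin k → Fin n) → PsizeWith 𝒜 i S x ≤ Psize 𝒜 i S
  PsizeWith≤Psize S x = countSubsets-mono λ H t →
    let bH , H#S , _ = Equivalence.to (PsizeWith-spec S x H) t in Equivalence.from (Psize-spec S H) (bH , H#S)

  PsizeWith-split : ∀ S s {k} (x : Fin k → Fin n) →
    PsizeWith 𝒜 i S x ≡ PsizeWith 𝒜 i S (s ∷ᶠ x) + PsizeWith 𝒜 i (S ∪ ⁅ s ⁆) x
  PsizeWith-split S s x = trans (countSubsets-split _ (λ H → lookup H s))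
    (cong₂ _+_ (countSubsets-cong λ H → mk⇔ (to-s∈ H) (from-s∈ H))
               (countSubsets-cong λ H → mk⇔ (to-s∉ H) (from-s∉ H)))
    where
    spec = PsizeWith-spec
    to-s∈ : ∀ H → T (avoidingBlockᵇ S x H ∧ lookup H s) → T (avoidingBlockᵇ S (s ∷ᶠ x) H)
    to-s∈ H t =
      let t₁ , s∈H = Equivalence.to T-∧ t
          bH , H#S , x⊆H = Equivalence.to (spec S x H) t₁
      in Equivalence.from (spec S (s ∷ᶠ x) H)
           (bH , H#S , λ { zero → Equivalence.to (T-lookup⇔∈ H s) s∈H ; (suc j) → x⊆H j })
    from-s∈ : ∀ H → T (avoidingBlockᵇ S (s ∷ᶠ x) H) → T (avoidingBlockᵇ S x H ∧ lookup H s)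
    from-s∈ H t =
      let bH , H#S , sx⊆H = Equivalence.to (spec S (s ∷ᶠ x) H) t
      in Equivalence.from T-∧ (Equivalence.from (spec S x H) (bH , H#S , sx⊆H ∘ suc) ,
                               Equivalence.from (T-lookup⇔∈ H s) (sx⊆H zero))
    to-s∉ : ∀ H → T (avoidingBlockᵇ S x H ∧ not (lookup H s)) → T (avoidingBlockᵇ (S ∪ ⁅ s ⁆) x H)
    to-s∉ H t =
      let t₁ , s∉H = Equivalence.to T-∧ t
          bH , H#S , x⊆H = Equivalence.to (spec S x H) t₁
          H#S∪s : Disjoint H (S ∪ ⁅ s ⁆)
          H#S∪s y∈H y∈ = case x∈p∪q⁻ S ⁅ s ⁆ y∈ of λ where
            (inj₁ y∈S) → H#S y∈H y∈S
            (inj₂ y∈⁅s⁆) → Equivalence.from (∉⇔T-not-lookup H s) s∉H (subst (_∈ H) (x∈⁅y⁆⇒x≡y s y∈⁅s⁆) y∈H)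
      in Equivalence.from (spec (S ∪ ⁅ s ⁆) x H) (bH , H#S∪s , x⊆H)
    from-s∉ : ∀ H → T (avoidingBlockᵇ (S ∪ ⁅ s ⁆) x H) → T (avoidingBlockᵇ S x H ∧ not (lookup H s))
    from-s∉ H t =
      let bH , H#S∪s , x⊆H = Equivalence.to (spec (S ∪ ⁅ s ⁆) x H) t
      in Equivalence.from T-∧ (Equivalence.from (spec S x H) (bH , (λ y∈H y∈S → H#S∪s y∈H (p⊆p∪q ⁅ s ⁆ y∈S)) , x⊆H) ,
                               Equivalence.to (∉⇔T-not-lookup H s) (λ s∈H → H#S∪s s∈H (q⊆p∪q S ⁅ s ⁆ (x∈⁅x⁆ s))))

  module _ {b c δ : ℕ} (secure : PerfectlySecure 𝒜 b c δ) (1≤δ : 1 ≤ δ) (δ≤a : δ ≤ a) where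

    private
      instance
        [a+b]Cδ≢0 : NonZero ((a + b) C δ)
        [a+b]Cδ≢0 = >-nonZero (nCk>0 (≤-trans δ≤a (m≤m+n a b)))

      secure′ : ∀ {S} → ∣ S ∣ ≡ c → Psize 𝒜 i S ≢ 0 → ∀ {x} → Outside S x →
        PsizeWith 𝒜 i S x * ((a + b) C δ) ≡ Psize 𝒜 i S * (a C δ)
      secure′ ∣S∣≡c P≢0 (inj , out) = secure δ 1≤δ ≤-refl i _ ∣S∣≡c P≢0 _ inj out

    secure⇒PsizeWith-constant : ∀ {S} → ∣ S ∣ ≡ c → ∀ {x x'} → Outside S x → Outside S x' →
      PsizeWith 𝒜 i S x ≡ PsizeWith 𝒜 i S x'
    secure⇒PsizeWith-constant {S} ∣S∣≡c {x} {x'} out out' with Psize 𝒜 i S ≟ 0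
    ... | yes P≡0 = trans (vanish x) (sym (vanish x'))
      where vanish = λ y → n≤0⇒n≡0 (subst (PsizeWith 𝒜 i S y ≤_) P≡0 (PsizeWith≤Psize S y))
    ... | no P≢0 = *-cancelʳ-≡ _ _ ((a + b) C δ) (trans (secure′ ∣S∣≡c P≢0 out) (sym (secure′ ∣S∣≡c P≢0 out')))

    secure⇒PsizeWith-pos : ∀ {S} → ∣ S ∣ ≡ c → 0 < Psize 𝒜 i S → ∀ {x} → Outside S x → 0 < PsizeWith 𝒜 i S x
    secure⇒PsizeWith-pos ∣S∣≡c 0<P out = n≢0⇒n>0 λ N≡0 →
      case m*n≡0⇒m≡0∨n≡0 _ (trans (sym (secure′ ∣S∣≡c (>⇒≢ 0<P) out)) (cong (_* _) N≡0)) of λ where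
        (inj₁ P≡0) → >⇒≢ 0<P P≡0
        (inj₂ C≡0) → >⇒≢ (nCk>0 δ≤a) C≡0

    secure⇒PsizeWith-swap : ∀ {Q s s' x x'} → suc ∣ Q ∣ ≡ c → s ∉ Q → s' ∉ Q →
      Outside (Q ∪ ⁅ s ⁆) x → Outside (Q ∪ ⁅ s' ⁆) x → Outside (Q ∪ ⁅ s ⁆) x' → Outside (Q ∪ ⁅ s' ⁆) x' →
      PsizeWith 𝒜 i Q (s ∷ᶠ x) + PsizeWith 𝒜 i Q (s' ∷ᶠ x') ≡ PsizeWith 𝒜 i Q (s' ∷ᶠ x) + PsizeWith 𝒜 i Q (s ∷ᶠ x')
    secure⇒PsizeWith-swap {Q} {s} {s'} {x} {x'} 1+∣Q∣≡c s∉Q s'∉Q sx s'x sx' s'x' =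
      cross (trans (sym (PsizeWith-split Q s x)) (PsizeWith-split Q s' x))
            (trans (sym (PsizeWith-split Q s x')) (PsizeWith-split Q s' x'))
            (secure⇒PsizeWith-constant (∣Q∪⁅_⁆∣≡c s∉Q) sx sx')
            (secure⇒PsizeWith-constant (∣Q∪⁅_⁆∣≡c s'∉Q) s'x s'x')
      where
      ∣Q∪⁅_⁆∣≡c : ∀ {t} → t ∉ Q → ∣ Q ∪ ⁅ t ⁆ ∣ ≡ c
      ∣Q∪⁅_⁆∣≡c t∉Q = trans (x∉p⇒∣p∪⁅x⁆∣≡1+∣p∣ t∉Q) 1+∣Q∣≡c
      cross : ∀ {α β γ ε A A' B B'} → α + A ≡ β + B → γ + A' ≡ ε + B' → A ≡ A' → B ≡ B' → α + ε ≡ β + γ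
      cross {α} {β} {γ} {ε} {A} {_} {B} e e' refl refl = +-cancelʳ-≡ (A + B) _ _ (begin
        α + ε + (A + B)   ≡⟨ shuffle α ε A B ⟩
        α + A + (ε + B)   ≡⟨ cong₂ _+_ e (sym e') ⟩
        β + B + (γ + A)   ≡⟨ shuffle′ β B γ A ⟩
        β + γ + (A + B)   ∎)
        where
        open ≡-Reasoning
        shuffle : ∀ α ε A B → α + ε + (A + B) ≡ α + A + (ε + B)
        shuffle = solve-∀
        shuffle′ : ∀ β B γ A → β + B + (γ + A) ≡ β + γ + (A + B)
        shuffle′ = solve-∀

-- Cathy cannot hold two cards

module CathyHasTwoCards {n a b c₁ : ℕ} (𝒜 : Announcements n a) (i : Fin (m 𝒜)) (T₀ : Subset n)
  (a≡ : a ≡ 2 + ∣ T₀ ∣ + (2 + c₁)) (a+b+c≡n : a + b + (2 + c₁) ≡ n) (1≤b : 1 ≤ b)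
  (informative : Informative 𝒜 b) (secure : PerfectlySecure 𝒜 b (2 + c₁) (suc ∣ T₀ ∣))
  where
  -- Cathy holds c = 2 + c₁ cards and T₀ has d − 2 cards, where d = a − c.

  open Enumeration (enumerate T₀) renaming (point to t; injective to t-injective; point∈ to t∈T₀)

  c k : ℕ
  c = 2 + c₁
  k = ∣ T₀ ∣

  BlockThrough : Subset n → Fin n → Fin n → Set
  BlockThrough H u v = Block 𝒜 i H × T₀ ⊆ H × u ∈ H × v ∈ H

  ∣block∣≡a : ∀ {H} → Block 𝒜 i H → ∣ H ∣ ≡ a
  ∣block∣≡a {H} = wf 𝒜 i H

  through⇔ : ∀ {z H} → (∀ j → (z ∷ᶠ t) j ∈ H) ⇔ (z ∈ H × T₀ ⊆ H)
  through⇔ = mk⇔ (λ z∷t⊆H → z∷t⊆H zero , λ {_} → points⊆⇒⊆ (z∷t⊆H ∘ suc))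
                 (λ { (z∈H , T₀⊆H) zero → z∈H ; (z∈H , T₀⊆H) (suc j) → T₀⊆H (t∈T₀ j) })

  ∷t-Outside : ∀ {S z} → z ∉ S → z ∉ T₀ → Disjoint T₀ S → Outside S (z ∷ᶠ t)
  ∷t-Outside {S} {z} z∉S z∉T₀ T₀#S = injective , λ where
      zero → z∉S
      (suc j) → T₀#S (t∈T₀ j)
    where
    injective : ∀ {j j'} → (z ∷ᶠ t) j ≡ (z ∷ᶠ t) j' → j ≡ j'
    injective {zero} {zero} _ = refl
    injective {zero} {suc j'} z≡ = contradiction (subst (_∈ T₀) (sym z≡) (t∈T₀ j')) z∉T₀
    injective {suc j} {zero} ≡z = contradiction (subst (_∈ T₀) ≡z (t∈T₀ j)) z∉T₀
    injective {suc j} {suc j'} eq = cong suc (t-injective eq)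

  BlockThrough-unique : ∀ {H H' u v} → u ≢ v → u ∉ T₀ → v ∉ T₀ → BlockThrough H u v → BlockThrough H' u v → H ≡ H'
  BlockThrough-unique {u = u} {v} u≢v u∉T₀ v∉T₀ (bH , T₀⊆H , u∈H , v∈H) (bH' , T₀⊆H' , u∈H' , v∈H') =
    informative⇒blocks-coincide 𝒜 i informative a+b+c≡n bH bH'
      (∪⁅⁆⊆ (∪⁅⁆⊆ T₀⊆H u∈H) v∈H) (∪⁅⁆⊆ (∪⁅⁆⊆ T₀⊆H' u∈H') v∈H') (≤-reflexive (trans a≡ (cong (_+ c) (sym ∣X∣≡2+k))))
    where
    ∣X∣≡2+k : ∣ (T₀ ∪ ⁅ u ⁆) ∪ ⁅ v ⁆ ∣ ≡ 2 + k
    ∣X∣≡2+k = trans (x∉p⇒∣p∪⁅x⁆∣≡1+∣p∣ (∉-∪⁅⁆⁺ v∉T₀ (u≢v ∘ sym))) (cong suc (x∉p⇒∣p∪⁅x⁆∣≡1+∣p∣ u∉T₀))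

  ∣T₀∪1pt∣≤ : ∀ x → ∣ T₀ ∪ ⁅ x ⁆ ∣ ≤ 1 + k
  ∣T₀∪1pt∣≤ x = ∣p∪⁅x⁆∣≤1+∣p∣ T₀ x

  ∣T₀∪2pts∣≤ : ∀ x y → ∣ (T₀ ∪ ⁅ x ⁆) ∪ ⁅ y ⁆ ∣ ≤ 2 + k
  ∣T₀∪2pts∣≤ x y = ≤-trans (∣p∪⁅x⁆∣≤1+∣p∣ (T₀ ∪ ⁅ x ⁆) y) (s≤s (∣T₀∪1pt∣≤ x))

  ∣T₀∪3pts∣≤ : ∀ x y w → ∣ ((T₀ ∪ ⁅ x ⁆) ∪ ⁅ y ⁆) ∪ ⁅ w ⁆ ∣ ≤ 3 + k
  ∣T₀∪3pts∣≤ x y w = ≤-trans (∣p∪⁅x⁆∣≤1+∣p∣ ((T₀ ∪ ⁅ x ⁆) ∪ ⁅ y ⁆) w) (s≤s (∣T₀∪2pts∣≤ x y))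

  2+k≤a : 2 + k ≤ a
  2+k≤a = subst (2 + k ≤_) (sym a≡) (m≤m+n _ _)

  1+k≤a : 1 + k ≤ a
  1+k≤a = ≤-trans (n≤1+n _) 2+k≤a

  3+k≤a : 3 + k ≤ a
  3+k≤a = subst (3 + k ≤_) (sym (trans a≡ (shuffle k c₁))) (m≤m+n _ _)
    where
    shuffle : ∀ k c₁ → 2 + k + (2 + c₁) ≡ 3 + k + (1 + c₁)
    shuffle = solve-∀

  a≡1+c₁+[3+k] : a ≡ 1 + c₁ + (3 + k)
  a≡1+c₁+[3+k] = trans a≡ (shuffle k c₁)
    where
    shuffle : ∀ k c₁ → 2 + k + (2 + c₁) ≡ 1 + c₁ + (3 + k)
    shuffle = solve-∀

  ∃∈block-outside : ∀ {H m} q → Block 𝒜 i H → ∣ q ∣ ≤ m → suc m ≤ a → ∃ λ x → x ∈ H × x ∉ q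
  ∃∈block-outside {H} q bH ∣q∣≤m 1+m≤a =
    ∃∈-outside H q (subst (∣ q ∣ <_) (sym (∣block∣≡a bH)) (≤-<-trans ∣q∣≤m 1+m≤a))

  ∃⊆block-outside : ∀ {H} q → Block 𝒜 i H → ∣ q ∣ ≤ 3 + k →
    ∃ λ r → r ⊆ H × Disjoint r q × ∣ r ∣ ≡ suc c₁
  ∃⊆block-outside {H} q bH ∣q∣≤3+k = ∃⊆-outside H q
    (subst (suc c₁ + ∣ q ∣ ≤_) (sym (∣block∣≡a bH))
      (≤-trans (+-monoʳ-≤ (suc c₁) ∣q∣≤3+k) (≤-reflexive (sym a≡1+c₁+[3+k]))))

  throughᵇ : Subset n → Fin n → Fin n → Subset n → Bool
  throughᵇ Q s z = avoidingBlockᵇ 𝒜 i Q (s ∷ᶠ z ∷ᶠ t)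

  #through : Subset n → Fin n → Fin n → ℕ
  #through Q s z = PsizeWith 𝒜 i Q (s ∷ᶠ z ∷ᶠ t)

  #through-spec : ∀ {Q s z} H →
    T (throughᵇ Q s z H) ⇔ (BlockThrough H s z × Disjoint H Q)
  #through-spec {Q} {s} {z} H = mk⇔ to from
    where
    spec = PsizeWith-spec 𝒜 i Q (s ∷ᶠ z ∷ᶠ t) H
    to : T (throughᵇ Q s z H) → BlockThrough H s z × Disjoint H Q
    to pH = let bH , H#Q , sz⊆H = Equivalence.to spec pH
                z∈H , T₀⊆H = Equivalence.to through⇔ (sz⊆H ∘ suc)
            in (bH , T₀⊆H , sz⊆H zero , z∈H) , H#Q
    from : BlockThrough H s z × Disjoint H Q → T (throughᵇ Q s z H)
    from ((bH , T₀⊆H , s∈H , z∈H) , H#Q) = Equivalence.from spec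
      (bH , H#Q , λ { zero → s∈H ; (suc j) → Equivalence.from through⇔ (z∈H , T₀⊆H) j })

  #through-pos : ∀ {Q s z H} → BlockThrough H s z → Disjoint H Q → 0 < #through Q s z
  #through-pos {Q} {s} {z} {H} through H#Q =
    countSubsets-pos {P = throughᵇ Q s z} (Equivalence.from (#through-spec H) (through , H#Q))

  #through-witness : ∀ {Q s z} → 0 < #through Q s z → ∃ λ H → BlockThrough H s z × Disjoint H Q
  #through-witness {Q} {s} {z} pos =
    let H , pH = countSubsets-witness {P = throughᵇ Q s z} pos in H , Equivalence.to (#through-spec H) pH

  #through-≤1 : ∀ {Q s z} → s ≢ z → s ∉ T₀ → z ∉ T₀ → #through Q s z ≤ 1
  #through-≤1 {Q} {s} {z} s≢z s∉T₀ z∉T₀ = countSubsets-≤1 {P = throughᵇ Q s z} λ {H} {H'} pH pH' →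
    BlockThrough-unique s≢z s∉T₀ z∉T₀
      (proj₁ (Equivalence.to (#through-spec H) pH)) (proj₁ (Equivalence.to (#through-spec H') pH'))

  #through-zero : ∀ {Q s z B q} → s ≢ z → s ∉ T₀ → z ∉ T₀ → BlockThrough B s z → q ∈ Q → q ∈ B → #through Q s z ≡ 0
  #through-zero {Q} {s} {z} s≢z s∉T₀ z∉T₀ B-through q∈Q q∈B =
    countSubsets-zero {P = throughᵇ Q s z} λ H pH →
    let H-through , H#Q = Equivalence.to (#through-spec H) pH
    in H#Q (subst (_ ∈_) (BlockThrough-unique s≢z s∉T₀ z∉T₀ B-through H-through) q∈B) q∈Q

  ∃block-through-avoiding : ∀ {S B z} → ∣ S ∣ ≡ c → Block 𝒜 i B → Disjoint B S → Disjoint T₀ S → z ∉ S → z ∉ T₀ →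
    ∃ λ H → Block 𝒜 i H × T₀ ⊆ H × z ∈ H × Disjoint H S
  ∃block-through-avoiding {S} {B} {z} ∣S∣≡c bB B#S T₀#S z∉S z∉T₀ =
    let H , bH , H#S , z∷t⊆H = PsizeWith-witness 𝒜 i
          (secure⇒PsizeWith-pos 𝒜 i secure (s≤s z≤n) 1+k≤a ∣S∣≡c (Psize-pos 𝒜 i bB B#S) (∷t-Outside z∉S z∉T₀ T₀#S))
        z∈H , T₀⊆H = Equivalence.to through⇔ z∷t⊆H
    in H , bH , T₀⊆H , z∈H , H#S

  Companion : Subset n → Set
  Companion B = ∃₂ λ B₂ p → Block 𝒜 i B₂ × T₀ ⊆ B₂ × p ∈ B × p ∈ B₂ × p ∉ T₀ × B ≢ B₂

  ∃companion : ∀ {B} → Block 𝒜 i B → T₀ ⊆ B → Companion B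
  ∃companion {B} bB T₀⊆B =
    let S , _ , S#B , ∣S∣≡c = ∃⊆-outside (⊤ {n}) B c+∣B∣≤n
        z , _ , z∉B∪S = ∃∈-outside (⊤ {n}) (B ∪ S) (∣B∪S∣<n S ∣S∣≡c)
        z∉B , z∉S = ∉-∪⁻ z∉B∪S
        Bz , bBz , T₀⊆Bz , z∈Bz , _ = ∃block-through-avoiding ∣S∣≡c bB (Disjoint-sym S#B)
                                        (λ x∈T₀ → Disjoint-sym S#B (T₀⊆B x∈T₀)) z∉S (z∉B ∘ T₀⊆B)
    in companion-from bBz T₀⊆Bz (λ B≡Bz → z∉B (subst (z ∈_) (sym B≡Bz) z∈Bz)) (nonempty? (Bz ∩ (B ─ T₀)))
    where
    open ≤-Reasoning
    c+∣B∣≤n : c + ∣ B ∣ ≤ ∣ ⊤ {n} ∣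
    c+∣B∣≤n = begin
      c + ∣ B ∣  ≡⟨ trans (cong (c +_) (∣block∣≡a bB)) (+-comm c a) ⟩
      a + c      ≤⟨ +-monoˡ-≤ c (m≤m+n a b) ⟩
      a + b + c  ≡⟨ trans a+b+c≡n (sym (∣⊤∣≡n n)) ⟩
      ∣ ⊤ {n} ∣  ∎
    ∣B∪S∣<n : ∀ S → ∣ S ∣ ≡ c → ∣ B ∪ S ∣ < ∣ ⊤ {n} ∣
    ∣B∪S∣<n S ∣S∣≡c = begin-strict
      ∣ B ∪ S ∣      ≤⟨ ∣p∪q∣≤∣p∣+∣q∣ B S ⟩
      ∣ B ∣ + ∣ S ∣  ≡⟨ cong₂ _+_ (∣block∣≡a bB) ∣S∣≡c ⟩
      a + c          <⟨ +-monoˡ-< c (m<m+n a 1≤b) ⟩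
      a + b + c      ≡⟨ trans a+b+c≡n (sym (∣⊤∣≡n n)) ⟩
      ∣ ⊤ {n} ∣      ∎
    block-meeting-B─T₀ : ∀ {Bz} → Block 𝒜 i Bz → T₀ ⊆ Bz → (∀ {x} → x ∈ Bz → x ∈ B → x ∉ T₀ → ⊥) → Companion B
    block-meeting-B─T₀ {Bz} bBz T₀⊆Bz Bz∩B⊆T₀ =
      let S₂ , S₂⊆B , S₂#T₀ , ∣S₂∣≡c = ∃⊆-outside B T₀ c+k≤∣B∣
          u , u∈B , u∉T₀∪S₂ = ∃∈-outside B (T₀ ∪ S₂) (∣T₀∪S₂∣<∣B∣ S₂ ∣S₂∣≡c)
          u∉T₀ , u∉S₂ = ∉-∪⁻ u∉T₀∪S₂
          Bu , bBu , T₀⊆Bu , u∈Bu , Bu#S₂ = ∃block-through-avoiding ∣S₂∣≡c bBz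
                                              (λ x∈Bz x∈S₂ → Bz∩B⊆T₀ x∈Bz (S₂⊆B x∈S₂) (S₂#T₀ x∈S₂))
                                              (Disjoint-sym S₂#T₀) u∉S₂ u∉T₀
          x , x∈S₂ = ∣p∣>0⇒Nonempty S₂ (subst (0 <_) (sym ∣S₂∣≡c) (s≤s z≤n))
      in Bu , u , bBu , T₀⊆Bu , u∈B , u∈Bu , u∉T₀ , λ B≡Bu → Bu#S₂ (subst (x ∈_) B≡Bu (S₂⊆B x∈S₂)) x∈S₂
      where
      ∣B∣≡2+[k+c] : ∣ B ∣ ≡ 2 + (k + c)
      ∣B∣≡2+[k+c] = trans (∣block∣≡a bB) a≡
      c+k≤∣B∣ : c + k ≤ ∣ B ∣
      c+k≤∣B∣ = begin
        c + k        ≡⟨ +-comm c k ⟩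
        k + c        ≤⟨ m≤n+m (k + c) 2 ⟩
        2 + (k + c)  ≡⟨ ∣B∣≡2+[k+c] ⟨
        ∣ B ∣        ∎
      ∣T₀∪S₂∣<∣B∣ : ∀ S₂ → ∣ S₂ ∣ ≡ c → ∣ T₀ ∪ S₂ ∣ < ∣ B ∣
      ∣T₀∪S₂∣<∣B∣ S₂ ∣S₂∣≡c = begin-strict
        ∣ T₀ ∪ S₂ ∣  ≤⟨ ∣p∪q∣≤∣p∣+∣q∣ T₀ S₂ ⟩
        k + ∣ S₂ ∣   ≡⟨ cong (k +_) ∣S₂∣≡c ⟩
        k + c        <⟨ s≤s (n≤1+n _) ⟩
        2 + (k + c)  ≡⟨ ∣B∣≡2+[k+c] ⟨
        ∣ B ∣        ∎
    companion-from : ∀ {Bz} → Block 𝒜 i Bz → T₀ ⊆ Bz → B ≢ Bz → Dec (Nonempty (Bz ∩ (B ─ T₀))) → Companion B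
    companion-from {Bz} bBz T₀⊆Bz B≢Bz (yes (p , p∈Bz∩[B─T₀])) =
      let p∈Bz , p∈B─T₀ = x∈p∩q⁻ Bz (B ─ T₀) p∈Bz∩[B─T₀]
      in Bz , p , bBz , T₀⊆Bz , p─q⊆p B T₀ p∈B─T₀ , p∈Bz , x∈p─q⇒x∉q B T₀ p∈B─T₀ , B≢Bz
    companion-from bBz T₀⊆Bz _ (no Bz∩[B─T₀]-empty) = block-meeting-B─T₀ bBz T₀⊆Bz λ x∈Bz x∈B x∉T₀ →
      Bz∩[B─T₀]-empty (_ , x∈p∩q⁺ (x∈Bz , x∈p∧x∉q⇒x∈p─q x∈B x∉T₀))

  module TwoBlocks {B B₂ Q Q₂ : Subset n} {p u s s' : Fin n}
    (bB : Block 𝒜 i B) (bB₂ : Block 𝒜 i B₂) (T₀⊆B : T₀ ⊆ B) (T₀⊆B₂ : T₀ ⊆ B₂)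
    (p∈B : p ∈ B) (p∈B₂ : p ∈ B₂) (p∉T₀ : p ∉ T₀) (B≢B₂ : B ≢ B₂)
    (u∈B : u ∈ B) (u∉ : u ∉ T₀ ∪ ⁅ p ⁆)
    (s'∈B : s' ∈ B) (s'∉ : s' ∉ (T₀ ∪ ⁅ p ⁆) ∪ ⁅ u ⁆)
    (s∈B₂ : s ∈ B₂) (s∉ : s ∉ T₀ ∪ ⁅ p ⁆)
    (Q⊆B : Q ⊆ B) (Q# : Disjoint Q (((T₀ ∪ ⁅ p ⁆) ∪ ⁅ u ⁆) ∪ ⁅ s' ⁆)) (∣Q∣≡ : ∣ Q ∣ ≡ suc c₁)
    (Q₂⊆B₂ : Q₂ ⊆ B₂) (Q₂# : Disjoint Q₂ ((T₀ ∪ ⁅ p ⁆) ∪ ⁅ s ⁆)) (∣Q₂∣≡ : ∣ Q₂ ∣ ≡ suc c₁)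
    where

    u∉T₀ = proj₁ (∉-∪⁅⁆⁻ u∉)
    u≢p = proj₂ (∉-∪⁅⁆⁻ u∉)
    s∉T₀ = proj₁ (∉-∪⁅⁆⁻ s∉)
    s≢p = proj₂ (∉-∪⁅⁆⁻ s∉)
    s'∉T₀ = proj₁ (∉-∪⁅⁆⁻ (proj₁ (∉-∪⁅⁆⁻ s'∉)))
    s'≢p = proj₂ (∉-∪⁅⁆⁻ (proj₁ (∉-∪⁅⁆⁻ s'∉)))
    s'≢u = proj₂ (∉-∪⁅⁆⁻ s'∉)

    B∩B₂⊆T₀∪⁅p⁆ : ∀ {x} → x ∈ B → x ∈ B₂ → x ∉ T₀ → x ≢ p → ⊥
    B∩B₂⊆T₀∪⁅p⁆ x∈B x∈B₂ x∉T₀ x≢p =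
      B≢B₂ (BlockThrough-unique x≢p x∉T₀ p∉T₀ (bB , T₀⊆B , x∈B , p∈B) (bB₂ , T₀⊆B₂ , x∈B₂ , p∈B₂))

    u∉B₂ : u ∉ B₂
    u∉B₂ u∈B₂ = B∩B₂⊆T₀∪⁅p⁆ u∈B u∈B₂ u∉T₀ u≢p

    s'∉B₂ : s' ∉ B₂
    s'∉B₂ s'∈B₂ = B∩B₂⊆T₀∪⁅p⁆ s'∈B s'∈B₂ s'∉T₀ s'≢p

    s∉B : s ∉ B
    s∉B s∈B = B∩B₂⊆T₀∪⁅p⁆ s∈B s∈B₂ s∉T₀ s≢p

    T₀#Q : Disjoint T₀ Q
    T₀#Q x∈T₀ x∈Q = Q# x∈Q (p⊆p∪q _ (p⊆p∪q _ (p⊆p∪q _ x∈T₀)))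

    T₀#Q₂ : Disjoint T₀ Q₂
    T₀#Q₂ x∈T₀ x∈Q₂ = Q₂# x∈Q₂ (p⊆p∪q _ (p⊆p∪q _ x∈T₀))

    p∉Q : p ∉ Q
    p∉Q p∈Q = Q# p∈Q (p⊆p∪q _ (p⊆p∪q _ (q⊆p∪q T₀ _ (x∈⁅x⁆ p))))

    u∉Q : u ∉ Q
    u∉Q u∈Q = Q# u∈Q (p⊆p∪q _ (q⊆p∪q _ _ (x∈⁅x⁆ u)))

    s'∉Q : s' ∉ Q
    s'∉Q s'∈Q = Q# s'∈Q (q⊆p∪q _ _ (x∈⁅x⁆ s'))

    p∉Q₂ : p ∉ Q₂
    p∉Q₂ p∈Q₂ = Q₂# p∈Q₂ (p⊆p∪q _ (q⊆p∪q T₀ _ (x∈⁅x⁆ p)))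

    s∉Q₂ : s ∉ Q₂
    s∉Q₂ s∈Q₂ = Q₂# s∈Q₂ (q⊆p∪q _ _ (x∈⁅x⁆ s))

    swap : ∀ {R} → ∣ R ∣ ≡ suc c₁ → Disjoint T₀ R → s ∉ R → s' ∉ R → p ∉ R → u ∉ R →
      #through R s p + #through R s' u ≡ #through R s' p + #through R s u
    swap {R} ∣R∣≡ T₀#R s∉R s'∉R p∉R u∉R =
      secure⇒PsizeWith-swap 𝒜 i secure (s≤s z≤n) 1+k≤a (cong suc ∣R∣≡) s∉R s'∉R
        (fresh p∉R (s≢p ∘ sym) s∉T₀ p∉T₀) (fresh p∉R (s'≢p ∘ sym) s'∉T₀ p∉T₀)
        (fresh u∉R u≢s s∉T₀ u∉T₀) (fresh u∉R (s'≢u ∘ sym) s'∉T₀ u∉T₀)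
      where
      u≢s : u ≢ s
      u≢s u≡s = s∉B (subst (_∈ B) u≡s u∈B)
      fresh : ∀ {z w} → z ∉ R → z ≢ w → w ∉ T₀ → z ∉ T₀ → Outside (R ∪ ⁅ w ⁆) (z ∷ᶠ t)
      fresh z∉R z≢w w∉T₀ z∉T₀ = ∷t-Outside (∉-∪⁅⁆⁺ z∉R z≢w) z∉T₀
        (λ x∈T₀ → ∉-∪⁅⁆⁺ (T₀#R x∈T₀) (λ x≡w → w∉T₀ (subst (_∈ T₀) x≡w x∈T₀)))

    third-block : ∃ λ H → BlockThrough H s u × Disjoint H Q
    third-block =
      #through-witness (subst (0 <_) #Q[s,p]≡#Q[s,u] (#through-pos (bB₂ , T₀⊆B₂ , s∈B₂ , p∈B₂) B₂#Q))
      where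
      open ≡-Reasoning
      q∈Q = proj₂ (∣p∣>0⇒Nonempty Q (subst (0 <_) (sym ∣Q∣≡) (s≤s z≤n)))
      B₂#Q : Disjoint B₂ Q
      B₂#Q x∈B₂ x∈Q =
        B∩B₂⊆T₀∪⁅p⁆ (Q⊆B x∈Q) x∈B₂ (λ x∈T₀ → T₀#Q x∈T₀ x∈Q) (λ x≡p → p∉Q (subst (_∈ Q) x≡p x∈Q))
      #Q[s',u]≡0 : #through Q s' u ≡ 0
      #Q[s',u]≡0 = #through-zero s'≢u s'∉T₀ u∉T₀ (bB , T₀⊆B , s'∈B , u∈B) q∈Q (Q⊆B q∈Q)
      #Q[s',p]≡0 : #through Q s' p ≡ 0
      #Q[s',p]≡0 = #through-zero s'≢p s'∉T₀ p∉T₀ (bB , T₀⊆B , s'∈B , p∈B) q∈Q (Q⊆B q∈Q)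
      #Q[s,p]≡#Q[s,u] : #through Q s p ≡ #through Q s u
      #Q[s,p]≡#Q[s,u] = begin
        #through Q s p                    ≡⟨ +-identityʳ _ ⟨
        #through Q s p + 0                ≡⟨ cong (#through Q s p +_) #Q[s',u]≡0 ⟨
        #through Q s p + #through Q s' u  ≡⟨ swap ∣Q∣≡ T₀#Q (s∉B ∘ Q⊆B) s'∉Q p∉Q u∉Q ⟩
        #through Q s' p + #through Q s u  ≡⟨ cong (_+ #through Q s u) #Q[s',p]≡0 ⟩
        #through Q s u                    ∎

    absurd : ⊥
    absurd = contradiction (begin
      2                                    ≤⟨ +-mono-≤ (#through-pos (bB , T₀⊆B , s'∈B , p∈B) B#Q₂)
                                                         (#through-pos H-through H#Q₂) ⟩
      #through Q₂ s' p + #through Q₂ s u   ≡⟨ swap ∣Q₂∣≡ T₀#Q₂ s∉Q₂ (s'∉B₂ ∘ Q₂⊆B₂) p∉Q₂ (u∉B₂ ∘ Q₂⊆B₂) ⟨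
      #through Q₂ s p + #through Q₂ s' u   ≡⟨ cong (_+ #through Q₂ s' u) #Q₂[s,p]≡0 ⟩
      #through Q₂ s' u                     ≤⟨ #through-≤1 s'≢u s'∉T₀ u∉T₀ ⟩
      1                                    ∎) λ { (s≤s ()) }
      where
      open ≤-Reasoning
      H = proj₁ third-block
      H-through = proj₁ (proj₂ third-block)
      q∈Q₂ = proj₂ (∣p∣>0⇒Nonempty Q₂ (subst (0 <_) (sym ∣Q₂∣≡) (s≤s z≤n)))
      #Q₂[s,p]≡0 : #through Q₂ s p ≡ 0
      #Q₂[s,p]≡0 = #through-zero s≢p s∉T₀ p∉T₀ (bB₂ , T₀⊆B₂ , s∈B₂ , p∈B₂) q∈Q₂ (Q₂⊆B₂ q∈Q₂)
      new-in-Q₂ : ∀ {x} → x ∈ Q₂ → x ∉ T₀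
      new-in-Q₂ x∈Q₂ x∈T₀ = T₀#Q₂ x∈T₀ x∈Q₂
      B#Q₂ : Disjoint B Q₂
      B#Q₂ x∈B x∈Q₂ =
        B∩B₂⊆T₀∪⁅p⁆ x∈B (Q₂⊆B₂ x∈Q₂) (new-in-Q₂ x∈Q₂) (λ x≡p → p∉Q₂ (subst (_∈ Q₂) x≡p x∈Q₂))
      H#Q₂ : Disjoint H Q₂
      H#Q₂ x∈H x∈Q₂ =
        let bH , T₀⊆H , s∈H , u∈H = H-through
            H≡B₂ = BlockThrough-unique (λ s≡x → s∉Q₂ (subst (_∈ Q₂) (sym s≡x) x∈Q₂)) s∉T₀ (new-in-Q₂ x∈Q₂)
                     (bH , T₀⊆H , s∈H , x∈H) (bB₂ , T₀⊆B₂ , s∈B₂ , Q₂⊆B₂ x∈Q₂)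
        in u∉B₂ (subst (u ∈_) H≡B₂ u∈H)

  companion⇒⊥ : ∀ {B} → Block 𝒜 i B → T₀ ⊆ B → Companion B → ⊥
  companion⇒⊥ {B} bB T₀⊆B (B₂ , p , bB₂ , T₀⊆B₂ , p∈B , p∈B₂ , p∉T₀ , B≢B₂) =
    let u , u∈B , u∉ = ∃∈block-outside (T₀ ∪ ⁅ p ⁆) bB (∣T₀∪1pt∣≤ p) 2+k≤a
        s' , s'∈B , s'∉ = ∃∈block-outside ((T₀ ∪ ⁅ p ⁆) ∪ ⁅ u ⁆) bB (∣T₀∪2pts∣≤ p u) 3+k≤a
        s , s∈B₂ , s∉ = ∃∈block-outside (T₀ ∪ ⁅ p ⁆) bB₂ (∣T₀∪1pt∣≤ p) 2+k≤a
        Q , Q⊆B , Q# , ∣Q∣≡ = ∃⊆block-outside (((T₀ ∪ ⁅ p ⁆) ∪ ⁅ u ⁆) ∪ ⁅ s' ⁆) bB (∣T₀∪3pts∣≤ p u s')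
        Q₂ , Q₂⊆B₂ , Q₂# , ∣Q₂∣≡ = ∃⊆block-outside ((T₀ ∪ ⁅ p ⁆) ∪ ⁅ s ⁆) bB₂
                                     (≤-trans (∣T₀∪2pts∣≤ p s) (n≤1+n _))
    in TwoBlocks.absurd bB bB₂ T₀⊆B T₀⊆B₂ p∈B p∈B₂ p∉T₀ B≢B₂
         u∈B u∉ s'∈B s'∉ s∈B₂ s∉ Q⊆B Q# ∣Q∣≡ Q₂⊆B₂ Q₂# ∣Q₂∣≡

  absurd : ∀ {B} → Block 𝒜 i B → T₀ ⊆ B → ⊥
  absurd bB T₀⊆B = companion⇒⊥ bB T₀⊆B (∃companion bB T₀⊆B)

theorem12 : (n a b c : ℕ) → 1 ≤ a → 1 ≤ b → 1 ≤ c → a + b + c ≡ n →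
    2 ≤ a ∸ c → (a ∸ c) ∸ 1 ≤ b →
    (𝒜 : Announcements n a) → Equitable 𝒜 → Informative 𝒜 b →
    PerfectlySecure 𝒜 b c ((a ∸ c) ∸ 1) →
    (a ≡ (a ∸ c) + 1) × (c ≡ 1)
theorem12 n a b (suc zero) 1≤a _ _ _ _ _ _ _ _ _ = sym (m∸n+n≡m 1≤a) , refl
-- Equitability is used only through covering, to obtain one block.
theorem12 n a b c@(suc (suc c₁)) _ 1≤b _ a+b+c≡n 2≤a∸c _ 𝒜 (covering , _) informative secure =
  let B , _ , ∣B∣≡a = ∃⊆-of-size (⊤ {n}) (subst (a ≤_) (sym (∣⊤∣≡n n)) a≤n)
      i , B∈𝒜ᵢ = covering B ∣B∣≡a
      T₀ , T₀⊆B , ∣T₀∣≡k = ∃⊆-of-size B (subst (k ≤_) (sym ∣B∣≡a) k≤a)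
  in ⊥-elim (CathyHasTwoCards.absurd 𝒜 i T₀
               (subst (λ x → a ≡ 2 + x + c) (sym ∣T₀∣≡k) a≡2+k+c) a+b+c≡n 1≤b informative
               (subst (PerfectlySecure 𝒜 b c) (trans (cong (_∸ 1) a∸c≡2+k) (cong suc (sym ∣T₀∣≡k))) secure)
               B∈𝒜ᵢ T₀⊆B)
  where
  k = a ∸ c ∸ 2
  a∸c≡2+k : a ∸ c ≡ 2 + k
  a∸c≡2+k = sym (trans (+-comm 2 k) (m∸n+n≡m 2≤a∸c))
  a≡2+k+c : a ≡ 2 + k + c
  a≡2+k+c = trans (sym (m∸n+n≡m (<⇒≤ c<a))) (cong (_+ c) a∸c≡2+k)
    where
    c<a : c < a
    c<a = m∸n≢0⇒n<m {a} {c} λ a∸c≡0 → contradiction (subst (2 ≤_) a∸c≡0 2≤a∸c) λ ()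
  a≤n : a ≤ n
  a≤n = subst (a ≤_) a+b+c≡n (≤-trans (m≤m+n a b) (m≤m+n (a + b) c))
  k≤a : k ≤ a
  k≤a = subst (k ≤_) (sym a≡2+k+c) (≤-trans (m≤m+n k c) (≤-trans (n≤1+n _) (n≤1+n _)))
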